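{- Let $K$ be a primary pseudoperfect number such that $K+1$ and $K^2+K+1$ are prime. Then $K' := K(K+1)$ and $K'' := K'(K'+1)$ are also primary pseudoperfect numbers, and if $6 \mid K$ then $K' \equiv K + 36 \pmod{864}$ and $K'' \equiv K + 72 \pmod{864}$.
   Context: A primary pseudoperfect number is an integer $K>1$ satisfying $\frac{1}{K} + \sum_{p \mid K} \frac{1}{p} = 1$, where the sum runs over the distinct primes $p$ dividing $K$. Note $864 = 6^3\cdot 4$. -}

module Defs where

open import Data.Nat using (ℕ; suc; _>_)
open import Data.Nat.Divisibility using (_∣_; _∣?_)
open import Data.Nat.Primality using (Prime; prime?)
open import Data.Integer using (+_)
open import Data.Rational using (ℚ; _/_; _+_; 0ℚ; 1ℚ)
open import Data.List using (List; upTo; filter; map; foldr)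
open import Data.Product using (_×_)
open import Data.Empty using (⊥)
open import Relation.Nullary.Decidable using (_×-dec_)
open import Relation.Binary.PropositionalEquality using (_≡_)

-- The distinct primes p dividing K, encoded as p = suc n with n < K
-- (every prime divisor of K > 0 lies in 1..K).  We store n = p - 1.
primeDivisorsPred : ℕ → List ℕ
primeDivisorsPred K = filter (λ n → prime? (suc n) ×-dec (suc n ∣? K)) (upTo K)

sumRecipPrimeDivisors : ℕ → ℚ
sumRecipPrimeDivisors K =
  foldr (λ n acc → ((+ 1) / suc n) + acc) 0ℚ (primeDivisorsPred K)

PrimaryPseudoperfect : ℕ → Set
PrimaryPseudoperfect 0 = ⊥
PrimaryPseudoperfect (suc k) =
  (suc k > 1) × (((+ 1) / suc k) + sumRecipPrimeDivisors (suc k) ≡ 1ℚ)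

module Submission where

-- Multiplying 1/K + Σ_{p ∣ K} 1/p = 1 by K shows that K > 1
--    is primary pseudoperfect iff 1 + Σ_{p ∣ K} K/p = K (an identity in ℕ).
-- 2. Oblong step.  If K + 1 is prime, the prime divisors of K(K+1) are those
--    of K together with K + 1; the integral form for K, multiplied by K + 1,
--    is then the integral form for K(K+1).  Applied twice (K² + K + 1 = K' + 1)
--    this gives the first two claims.
-- 3. Squarefreeness.  If p² ∣ K then p divides every K/q, so the integral form
--    forces p ∣ 1.  Hence 4 ∤ K and 9 ∤ K.
-- 4. Congruences.  With K = 6m and m prime to 6 we have m² ≡ 1 (mod 24), so
--    K(K+1) = K + 36m² ≡ K + 36 (mod 864); and K' = 6·m(6m+1) with m(6m+1)
--    again prime to 6, so the same congruence applies to K'.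

open import Defs
open import Data.Nat using (ℕ; _+_; _*_; _%_)
open import Data.Nat.Divisibility using (_∣_)
open import Data.Nat.Primality using (Prime)
open import Data.Product using (_×_)
open import Relation.Binary.PropositionalEquality using (_≡_)

open import Function.Base using (id)
open import Data.Empty using (⊥)
open import Data.Sum.Base using (_⊎_; inj₁; inj₂)
open import Data.Product using (_,_; proj₁; proj₂)
open import Data.Nat.Base using (zero; suc; _/_; _<_; NonZero; s≤s)
open import Data.Nat.Properties
  using (_≟_; allUpTo?; suc-injective; +-comm; +-assoc; *-comm; *-zeroʳ; *-identityˡ; *-identityʳ;
         *-distribˡ-+; +-identityʳ; m≤m+n; n≤1+n; ≤-trans; <-≤-trans; m≤m*n; <⇒≢; m≢1+m+n)
open import Data.Nat.DivMod
  using (m/n*n≡m; m*n/n≡m; *-/-assoc; m%n<n; m≡m%n+[m/n]*n; [m+kn]%n≡m%n; %-distribˡ-+; %-distribˡ-*)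
open import Data.Nat.Divisibility
  using (_∣?_; divides; ∣1⇒≡1; ∣m∣n⇒∣m+n; ∣m+n∣m⇒∣n; ∣m⇒∣m*n; ∣n⇒∣m*n; n∣m*n;
         m*n∣⇒m∣; m*n∣o⇒m∣o/n; *-pres-∣; ∣n∣m%n⇒∣m; >⇒∤)
open import Data.Nat.Primality using (prime?; prime[2]; ¬prime[1]; euclidsLemma; prime⇒irreducible)
open import Data.Nat.ListAction using (sum)
open import Data.Nat.ListAction.Properties using (sum-++)
open import Data.Nat.Tactic.RingSolver using (solve-∀)
import Data.Integer.Base as ℤ
open import Data.Integer.Properties using (pos-+; pos-*) renaming (+-injective to +-injectiveℤ)
open import Data.Rational.Base as ℚ using (0ℚ; toℚᵘ)
open import Data.Rational.Properties using (toℚᵘ-homo-+; toℚᵘ-fromℚᵘ; toℚᵘ-injective; toℚᵘ-cong)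
open import Data.Rational.Unnormalised.Base using (ℚᵘ; mkℚᵘ; _≃_; *≡*; 0ℚᵘ; 1ℚᵘ)
  renaming (_+_ to _+ᵘ_)
open import Data.Rational.Unnormalised.Properties using (≃-refl; ≃-reflexive; ≃-sym; ≃-trans; +-cong)
open import Data.List.Base using (List; []; _∷_; [_]; _++_; foldr; map; filter; upTo; applyUpTo)
open import Data.List.Properties
  using (map-++; filter-++; filter-accept; filter-reject; filter-none; upTo-∷ʳ; ++-identityʳ)
open import Data.List.Relation.Unary.All as All using (All; []; _∷_)
open import Data.List.Relation.Unary.All.Properties using (all-filter; map⁺; applyUpTo⁺₁; applyUpTo⁺₂)
open import Relation.Nullary using (¬_; yes; no; contradiction)
open import Relation.Nullary.Decidable using (_×-dec_; _⊎-dec_; from-yes)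
open import Relation.Unary using (Pred; Decidable)
open import Relation.Binary.PropositionalEquality using (refl; sym; trans; cong; cong₂; subst; module ≡-Reasoning)

open ≡-Reasoning

prime∣prime⇒≡ : ∀ {p q} → Prime p → Prime q → p ∣ q → p ≡ q
prime∣prime⇒≡ prime-p prime-q p∣q with prime⇒irreducible prime-q p∣q
... | inj₁ refl = contradiction prime-p ¬prime[1]
... | inj₂ p≡q  = p≡q

prime∤consecutive : ∀ {p m} → Prime p → p ∣ m → ¬ p ∣ m + 1
prime∤consecutive prime-p p∣m p∣m+1 =
  contradiction (subst Prime (∣1⇒≡1 (∣m+n∣m⇒∣n p∣m+1 p∣m)) prime-p) ¬prime[1]

prime[3] : Prime 3
prime[3] = from-yes (prime? 3)

-- Unnormalised fractions a/(d+1) with natural numerator, and the identity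
-- "1/K + Σ 1/p = 1" rewritten over the common denominator K.

frac : ℕ → ℕ → ℚᵘ
frac a d = mkℚᵘ (ℤ.+ a) d

frac-≃ : ∀ {a d b e} → a * suc e ≡ b * suc d → frac a d ≃ frac b e
frac-≃ {a} {d} {b} {e} eq =
  *≡* (trans (sym (pos-* a (suc e))) (trans (cong ℤ.+_ eq) (pos-* b (suc d))))

frac-≃⁻ : ∀ {a d b e} → frac a d ≃ frac b e → a * suc e ≡ b * suc d
frac-≃⁻ {a} {d} {b} {e} (*≡* eq) =
  +-injectiveℤ (trans (pos-* a (suc e)) (trans eq (sym (pos-* b (suc d)))))

frac≃1 : ∀ {a k} → frac a k ≃ 1ℚᵘ → a ≡ suc k
frac≃1 {a} {k} eq = trans (sym (*-identityʳ a)) (trans (frac-≃⁻ eq) (*-identityˡ (suc k)))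

frac-K/K≃1 : ∀ {k} → frac (suc k) k ≃ 1ℚᵘ
frac-K/K≃1 {k} = frac-≃ (trans (*-identityʳ (suc k)) (sym (*-identityˡ (suc k))))

frac-+ : ∀ a d b e → frac a d +ᵘ frac b e ≡ frac (a * suc e + b * suc d) (e + d * suc e)
frac-+ a d b e = cong (λ n → mkℚᵘ n (e + d * suc e)) (sym
  (trans (pos-+ (a * suc e) (b * suc d)) (cong₂ ℤ._+_ (pos-* a (suc e)) (pos-* b (suc d)))))

frac-+-common : ∀ a b k → frac a k +ᵘ frac b k ≃ frac (a + b) k
frac-+-common a b k = ≃-trans (≃-reflexive (frac-+ a k b k)) (frac-≃ (cross a b k))
  where
  cross : ∀ a b k → (a * suc k + b * suc k) * suc k ≡ (a + b) * (suc k * suc k)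
  cross = solve-∀

frac-divisor : ∀ {n k} → suc n ∣ suc k → frac 1 n ≃ frac (suc k / suc n) k
frac-divisor {n} {k} d∣K = frac-≃ (trans (*-identityˡ (suc k)) (sym (m/n*n≡m d∣K)))

reciprocalSum : List ℕ → ℚᵘ
reciprocalSum = foldr (λ n s → frac 1 n +ᵘ s) 0ℚᵘ

toℚᵘ-reciprocalSum : ∀ L →
  toℚᵘ (foldr (λ n acc → ((ℤ.+ 1) ℚ./ suc n) ℚ.+ acc) 0ℚ L) ≃ reciprocalSum L
toℚᵘ-reciprocalSum []      = ≃-refl
toℚᵘ-reciprocalSum (n ∷ L) = ≃-trans
  (toℚᵘ-homo-+ ((ℤ.+ 1) ℚ./ suc n) (foldr (λ n acc → ((ℤ.+ 1) ℚ./ suc n) ℚ.+ acc) 0ℚ L))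
  (+-cong (toℚᵘ-fromℚᵘ (frac 1 n)) (toℚᵘ-reciprocalSum L))

-- Σ_{n ∈ L} K/(n+1): the reciprocal sum multiplied by K.
cofactorSum : ℕ → List ℕ → ℕ
cofactorSum K L = sum (map (λ n → K / suc n) L)

reciprocalSum-cofactors : ∀ {k} L → All (λ n → suc n ∣ suc k) L →
  reciprocalSum L ≃ frac (cofactorSum (suc k) L) k
reciprocalSum-cofactors []      []           = frac-≃ refl
reciprocalSum-cofactors {k} (n ∷ L) (d∣K ∷ d∣Ks) = ≃-trans
  (+-cong (frac-divisor d∣K) (reciprocalSum-cofactors L d∣Ks))
  (frac-+-common (suc k / suc n) (cofactorSum (suc k) L) k)

cofactorSum-++ : ∀ K xs ys → cofactorSum K (xs ++ ys) ≡ cofactorSum K xs + cofactorSum K ys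
cofactorSum-++ K xs ys = trans (cong sum (map-++ cofactor xs ys)) (sum-++ (map cofactor xs) (map cofactor ys))
  where
  cofactor : ℕ → ℕ
  cofactor n = K / suc n

cofactorSum-scale : ∀ c K L → All (λ n → suc n ∣ K) L → cofactorSum (c * K) L ≡ c * cofactorSum K L
cofactorSum-scale c K []      []           = sym (*-zeroʳ c)
cofactorSum-scale c K (n ∷ L) (d∣K ∷ d∣Ks) = begin
  c * K / suc n + cofactorSum (c * K) L       ≡⟨ cong₂ _+_ (*-/-assoc c d∣K) (cofactorSum-scale c K L d∣Ks) ⟩
  c * (K / suc n) + c * cofactorSum K L       ≡⟨ *-distribˡ-+ c (K / suc n) (cofactorSum K L) ⟨
  c * (K / suc n + cofactorSum K L)           ∎

primeDivisors-divide : ∀ K → All (λ n → Prime (suc n) × suc n ∣ K) (primeDivisorsPred K)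
primeDivisors-divide K = all-filter (λ n → prime? (suc n) ×-dec (suc n ∣? K)) (upTo K)

pseudoperfectSum-integral : ∀ k →
  toℚᵘ (((ℤ.+ 1) ℚ./ suc k) ℚ.+ sumRecipPrimeDivisors (suc k))
    ≃ frac (1 + cofactorSum (suc k) (primeDivisorsPred (suc k))) k
pseudoperfectSum-integral k = ≃-trans
  (toℚᵘ-homo-+ ((ℤ.+ 1) ℚ./ suc k) (sumRecipPrimeDivisors (suc k)))
  (≃-trans
    (+-cong (toℚᵘ-fromℚᵘ (frac 1 k))
            (≃-trans (toℚᵘ-reciprocalSum (primeDivisorsPred (suc k)))
                     (reciprocalSum-cofactors _ (All.map proj₂ (primeDivisors-divide (suc k))))))
    (frac-+-common 1 _ k))

pseudoperfect⇒integral : ∀ {K} → PrimaryPseudoperfect K →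
  1 + cofactorSum K (primeDivisorsPred K) ≡ K
pseudoperfect⇒integral {suc k} (_ , eq) =
  frac≃1 (≃-trans (≃-sym (pseudoperfectSum-integral k)) (toℚᵘ-cong eq))

integral⇒pseudoperfect : ∀ {K} → 1 < K → 1 + cofactorSum K (primeDivisorsPred K) ≡ K →
  PrimaryPseudoperfect K
integral⇒pseudoperfect {suc k} 1<K eq = 1<K , toℚᵘ-injective (≃-trans
  (pseudoperfectSum-integral k) (≃-trans (≃-reflexive (cong (λ a → frac a k) eq)) frac-K/K≃1))

filter-agree : ∀ {a p q} {A : Set a} {P : Pred A p} {Q : Pred A q}
  (P? : Decidable P) (Q? : Decidable Q) {xs} →
  All (λ x → (P x → Q x) × (Q x → P x)) xs → filter P? xs ≡ filter Q? xs
filter-agree P? Q? [] = refl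
filter-agree P? Q? {x ∷ _} ((P⇒Q , Q⇒P) ∷ agree) with P? x
... | yes Px = trans (cong (x ∷_) (filter-agree P? Q? agree)) (sym (filter-accept Q? (P⇒Q Px)))
... | no ¬Px = trans (filter-agree P? Q? agree) (sym (filter-reject Q? (λ Qx → ¬Px (Q⇒P Qx))))

applyUpTo-+ : ∀ {A : Set} (f : ℕ → A) m k →
  applyUpTo f (m + k) ≡ applyUpTo f m ++ applyUpTo (λ i → f (m + i)) k
applyUpTo-+ f zero    k = refl
applyUpTo-+ f (suc m) k = cong (f 0 ∷_) (applyUpTo-+ (λ i → f (suc i)) m k)

prime∣oblong : ∀ {K q} → Prime (suc K) → Prime q → q ∣ K * suc K → q ∣ K ⊎ q ≡ suc K
prime∣oblong {K} prime-K+1 prime-q q∣N with euclidsLemma K (suc K) prime-q q∣N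
... | inj₁ q∣K   = inj₁ q∣K
... | inj₂ q∣K+1 = inj₂ (prime∣prime⇒≡ prime-q prime-K+1 q∣K+1)

-- For K > 0 with K + 1 prime, the prime divisors of K(K+1) are those of K
-- followed by K + 1 (encoded as K): below K the two filters agree, at K the
-- new prime K + 1 is accepted, and nothing beyond K + 1 is a prime divisor.
primeDivisors-oblong : ∀ K .{{_ : NonZero K}} → Prime (suc K) →
  primeDivisorsPred (K * suc K) ≡ primeDivisorsPred K ++ [ K ]
primeDivisors-oblong K@(suc k) prime-K+1 = begin
  filter P? (upTo (suc K + k * suc K))             ≡⟨ cong (filter P?) (applyUpTo-+ id (suc K) (k * suc K)) ⟩
  filter P? (upTo (suc K) ++ beyond)               ≡⟨ cong (λ xs → filter P? (xs ++ beyond)) (upTo-∷ʳ K) ⟨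
  filter P? ((upTo K ++ [ K ]) ++ beyond)          ≡⟨ filter-++ P? (upTo K ++ [ K ]) beyond ⟩
  filter P? (upTo K ++ [ K ]) ++ filter P? beyond  ≡⟨ cong₂ _++_ (filter-++ P? (upTo K) [ K ]) (filter-none P? beyond-rejected) ⟩
  (filter P? (upTo K) ++ filter P? [ K ]) ++ []    ≡⟨ ++-identityʳ _ ⟩
  filter P? (upTo K) ++ filter P? [ K ]            ≡⟨ cong₂ _++_ (filter-agree P? Q? below-agree) (filter-accept P? (prime-K+1 , n∣m*n K)) ⟩
  filter Q? (upTo K) ++ [ K ]                      ∎
  where
  N : ℕ
  N = K * suc K
  P? : Decidable (λ n → Prime (suc n) × suc n ∣ N)
  P? n = prime? (suc n) ×-dec (suc n ∣? N)
  Q? : Decidable (λ n → Prime (suc n) × suc n ∣ K)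
  Q? n = prime? (suc n) ×-dec (suc n ∣? K)
  beyond : List ℕ
  beyond = applyUpTo (λ i → suc K + i) (k * suc K)

  below-agree : All (λ n → (Prime (suc n) × suc n ∣ N → Prime (suc n) × suc n ∣ K)
                         × (Prime (suc n) × suc n ∣ K → Prime (suc n) × suc n ∣ N)) (upTo K)
  below-agree = applyUpTo⁺₁ id K λ {n} n<K →
    (λ (prime-q , q∣N) → prime-q , (case-below n<K (prime∣oblong prime-K+1 prime-q q∣N))) ,
    (λ (prime-q , q∣K) → prime-q , ∣m⇒∣m*n (suc K) q∣K)
    where
    case-below : ∀ {n} → n < K → suc n ∣ K ⊎ suc n ≡ suc K → suc n ∣ K
    case-below n<K (inj₁ q∣K) = q∣K
    case-below n<K (inj₂ q≡K+1) = contradiction (suc-injective q≡K+1) (<⇒≢ n<K)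

  beyond-rejected : All (λ n → ¬ (Prime (suc n) × suc n ∣ N)) beyond
  beyond-rejected = applyUpTo⁺₂ (λ i → suc K + i) (k * suc K) λ i (prime-q , q∣N) →
    case-beyond i (prime∣oblong prime-K+1 prime-q q∣N)
    where
    case-beyond : ∀ i → suc (suc K + i) ∣ K ⊎ suc (suc K + i) ≡ suc K → ⊥
    case-beyond i (inj₁ q∣K) = >⇒∤ (s≤s (≤-trans (n≤1+n K) (m≤m+n (suc K) i))) q∣K
    case-beyond i (inj₂ q≡K+1) = m≢1+m+n K (sym (suc-injective q≡K+1))

-- If K is primary pseudoperfect and K + 1 is prime, then so is K(K+1):
-- Σ_{p ∣ K(K+1)} K(K+1)/p = (K+1) Σ_{p ∣ K} K/p + K.
pseudoperfect-oblong : ∀ K → PrimaryPseudoperfect K → Prime (K + 1) →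
  PrimaryPseudoperfect (K * (K + 1))
pseudoperfect-oblong K@(suc _) pp prime-K+1 = subst (λ M → PrimaryPseudoperfect (K * M)) (+-comm 1 K)
  (integral⇒pseudoperfect (<-≤-trans (proj₁ pp) (m≤m*n K (suc K))) (begin
    1 + cofactorSum N (primeDivisorsPred N)                        ≡⟨ cong (λ L → 1 + cofactorSum N L) divisors-N ⟩
    1 + cofactorSum N (primeDivisorsPred K ++ [ K ])               ≡⟨ cong (1 +_) (cofactorSum-++ N (primeDivisorsPred K) [ K ]) ⟩
    1 + (cofactorSum N (primeDivisorsPred K) + cofactorSum N [ K ]) ≡⟨ cong₂ (λ s t → 1 + (s + t)) scaled cofactor-K+1 ⟩
    1 + (suc K * S + K)                                            ≡⟨ oblong-identity (pseudoperfect⇒integral pp) ⟩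
    N                                                              ∎))
  where
  N S : ℕ
  N = K * suc K
  S = cofactorSum K (primeDivisorsPred K)

  divisors-N : primeDivisorsPred N ≡ primeDivisorsPred K ++ [ K ]
  divisors-N = primeDivisors-oblong K (subst Prime (+-comm K 1) prime-K+1)

  scaled : cofactorSum N (primeDivisorsPred K) ≡ suc K * S
  scaled = trans (cong (λ M → cofactorSum M (primeDivisorsPred K)) (*-comm K (suc K)))
                 (cofactorSum-scale (suc K) K (primeDivisorsPred K) (All.map proj₂ (primeDivisors-divide K)))

  cofactor-K+1 : cofactorSum N [ K ] ≡ K
  cofactor-K+1 = trans (+-identityʳ (N / suc K)) (m*n/n≡m K (suc K))

  oblong-identity : ∀ {s k} → 1 + s ≡ k → 1 + (suc k * s + k) ≡ k * suc k
  oblong-identity {s} refl = identity s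
    where
    identity : ∀ s → 1 + (suc (1 + s) * s + (1 + s)) ≡ (1 + s) * suc (1 + s)
    identity = solve-∀

∣-sum : ∀ {d ns} → All (d ∣_) ns → d ∣ sum ns
∣-sum []           = divides 0 refl
∣-sum (d∣n ∷ d∣ns) = ∣m∣n⇒∣m+n d∣n (∣-sum d∣ns)

square∣⇒∣cofactor : ∀ {p q K} .{{_ : NonZero q}} → Prime p → p * p ∣ K → Prime q → q ∣ K → p ∣ K / q
square∣⇒∣cofactor {p} {q} {K} prime-p p²∣K prime-q q∣K with p ≟ q
... | yes refl = m*n∣o⇒m∣o/n p p p²∣K
... | no p≢q with euclidsLemma (K / q) q prime-p (subst (p ∣_) (sym (m/n*n≡m q∣K)) (m*n∣⇒m∣ p p p²∣K))
...   | inj₁ p∣K/q = p∣K/q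
...   | inj₂ p∣q   = contradiction (prime∣prime⇒≡ prime-p prime-q p∣q) p≢q

pseudoperfect⇒squarefree : ∀ {K p} → PrimaryPseudoperfect K → Prime p → ¬ p * p ∣ K
pseudoperfect⇒squarefree {K} {p} pp prime-p p²∣K =
  prime∤consecutive prime-p p∣S (subst (p ∣_) (trans (sym (pseudoperfect⇒integral pp)) (+-comm 1 S)) p∣K)
  where
  S : ℕ
  S = cofactorSum K (primeDivisorsPred K)
  p∣K : p ∣ K
  p∣K = m*n∣⇒m∣ p p p²∣K
  p∣S : p ∣ S
  p∣S = ∣-sum (map⁺ (All.map (λ (prime-q , q∣K) → square∣⇒∣cofactor prime-p p²∣K prime-q q∣K)
                             (primeDivisors-divide K)))

residues-mod-24 : ∀ {r} → r < 24 → 2 ∣ r ⊎ 3 ∣ r ⊎ r * r % 24 ≡ 1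
residues-mod-24 = from-yes (allUpTo? (λ r → 2 ∣? r ⊎-dec 3 ∣? r ⊎-dec r * r % 24 ≟ 1) 24)

square≡1-mod-24 : ∀ m → ¬ 2 ∣ m → ¬ 3 ∣ m → m * m % 24 ≡ 1
square≡1-mod-24 m 2∤m 3∤m with residues-mod-24 (m%n<n m 24)
... | inj₁ 2∣r        = contradiction (∣n∣m%n⇒∣m (divides 12 refl) 2∣r) 2∤m
... | inj₂ (inj₁ 3∣r) = contradiction (∣n∣m%n⇒∣m (divides 8 refl) 3∣r) 3∤m
... | inj₂ (inj₂ r²≡1) = trans (%-distribˡ-* m m 24) r²≡1

-- For K = 6m with m prime to 6: K(K+1) = K + 36 m² ≡ K + 36 (mod 864).
oblong-mod-864 : ∀ m → ¬ 2 ∣ m → ¬ 3 ∣ m → (m * 6) * (m * 6 + 1) % 864 ≡ (m * 6 + 36) % 864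
oblong-mod-864 m 2∤m 3∤m = trans (cong (_% 864) expand) ([m+kn]%n≡m%n (m * 6 + 36) j 864)
  where
  j : ℕ
  j = m * m / 24
  m²≡1+24j : m * m ≡ 1 + j * 24
  m²≡1+24j = trans (m≡m%n+[m/n]*n (m * m) 24) (cong (_+ j * 24) (square≡1-mod-24 m 2∤m 3∤m))

  expand : (m * 6) * (m * 6 + 1) ≡ (m * 6 + 36) + j * 864
  expand = begin
    (m * 6) * (m * 6 + 1)    ≡⟨ square-form m ⟩
    m * 6 + 36 * (m * m)     ≡⟨ cong (λ x → m * 6 + 36 * x) m²≡1+24j ⟩
    m * 6 + 36 * (1 + j * 24) ≡⟨ regroup m j ⟩
    (m * 6 + 36) + j * 864   ∎
    where
    square-form : ∀ m → (m * 6) * (m * 6 + 1) ≡ m * 6 + 36 * (m * m)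
    square-form = solve-∀
    regroup : ∀ m j → m * 6 + 36 * (1 + j * 24) ≡ (m * 6 + 36) + j * 864
    regroup = solve-∀

prime∤oblong : ∀ {p c m} → Prime p → p ∣ c → ¬ p ∣ m → ¬ p ∣ m * (m * c + 1)
prime∤oblong {p} {c} {m} prime-p p∣c p∤m p∣m[mc+1] with euclidsLemma m (m * c + 1) prime-p p∣m[mc+1]
... | inj₁ p∣m      = p∤m p∣m
... | inj₂ p∣mc+1   = prime∤consecutive prime-p (∣n⇒∣m*n m p∣c) p∣mc+1

%-congˡ-+ : ∀ a b c d .{{_ : NonZero d}} → a % d ≡ b % d → (a + c) % d ≡ (b + c) % d
%-congˡ-+ a b c d a≡b = begin
  (a + c) % d             ≡⟨ %-distribˡ-+ a c d ⟩
  (a % d + c % d) % d     ≡⟨ cong (λ x → (x + c % d) % d) a≡b ⟩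
  (b % d + c % d) % d     ≡⟨ %-distribˡ-+ b c d ⟨
  (b + c) % d             ∎

congruences-mod-864 : ∀ {K} → 6 ∣ K → ¬ 4 ∣ K → ¬ 9 ∣ K →
  ((K * (K + 1)) % 864 ≡ (K + 36) % 864)
  × (((K * (K + 1)) * (K * (K + 1) + 1)) % 864 ≡ (K + 72) % 864)
congruences-mod-864 (divides m refl) 4∤K 9∤K = K'≡K+36 , (begin
  K' * (K' + 1) % 864         ≡⟨ cong (λ x → x * (x + 1) % 864) K'≡6m' ⟩
  (m' * 6) * (m' * 6 + 1) % 864 ≡⟨ oblong-mod-864 m' 2∤m' 3∤m' ⟩
  (m' * 6 + 36) % 864          ≡⟨ cong (λ x → (x + 36) % 864) K'≡6m' ⟨
  (K' + 36) % 864              ≡⟨ %-congˡ-+ K' (m * 6 + 36) 36 864 K'≡K+36 ⟩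
  (m * 6 + 36 + 36) % 864      ≡⟨ cong (_% 864) (+-assoc (m * 6) 36 36) ⟩
  (m * 6 + 72) % 864           ∎)
  where
  2∣6 : 2 ∣ 6
  2∣6 = divides 3 refl
  3∣6 : 3 ∣ 6
  3∣6 = divides 2 refl
  2∤m : ¬ 2 ∣ m
  2∤m 2∣m = 4∤K (*-pres-∣ 2∣m 2∣6)
  3∤m : ¬ 3 ∣ m
  3∤m 3∣m = 9∤K (*-pres-∣ 3∣m 3∣6)
  K' : ℕ
  K' = (m * 6) * (m * 6 + 1)
  K'≡K+36 : K' % 864 ≡ (m * 6 + 36) % 864
  K'≡K+36 = oblong-mod-864 m 2∤m 3∤m
  m' : ℕ
  m' = m * (m * 6 + 1)
  K'≡6m' : K' ≡ m' * 6
  K'≡6m' = regroup m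
    where
    regroup : ∀ m → (m * 6) * (m * 6 + 1) ≡ (m * (m * 6 + 1)) * 6
    regroup = solve-∀
  2∤m' : ¬ 2 ∣ m'
  2∤m' = prime∤oblong prime[2] 2∣6 2∤m
  3∤m' : ¬ 3 ∣ m'
  3∤m' = prime∤oblong prime[3] 3∣6 3∤m

proposition4 : (K : ℕ) → PrimaryPseudoperfect K → Prime (K + 1) → Prime (K * K + K + 1) →
    PrimaryPseudoperfect (K * (K + 1))
    × PrimaryPseudoperfect ((K * (K + 1)) * (K * (K + 1) + 1))
    × (6 ∣ K →
    ((K * (K + 1)) % 864 ≡ (K + 36) % 864)
    × (((K * (K + 1)) * (K * (K + 1) + 1)) % 864 ≡ (K + 72) % 864))
proposition4 K pp prime-K+1 prime-K²+K+1 = pp′ , pp″ , λ 6∣K →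
  congruences-mod-864 6∣K (pseudoperfect⇒squarefree pp prime[2]) (pseudoperfect⇒squarefree pp prime[3])
  where
  pp′ : PrimaryPseudoperfect (K * (K + 1))
  pp′ = pseudoperfect-oblong K pp prime-K+1

  -- K² + K + 1 = K' + 1, so the oblong step applies again to K'.
  pp″ : PrimaryPseudoperfect ((K * (K + 1)) * (K * (K + 1) + 1))
  pp″ = pseudoperfect-oblong (K * (K + 1)) pp′ (subst Prime (K²+K+1≡K′+1 K) prime-K²+K+1)
    where
    K²+K+1≡K′+1 : ∀ K → K * K + K + 1 ≡ K * (K + 1) + 1
    K²+K+1≡K′+1 = solve-∀
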